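{- For all integers $n,p\geq0$, \[ \mathcal{B}_{n+1,p}=(n+1)\mathcal{B}_{n,p}-\sum_{k=0}^{n-2}\binom{n}{k}(-1)^{n-k}\mathcal{B}_{k+1,p}-\frac{p}{p+1}\mathcal{B}_{n,p+1}, \] with $\mathcal{B}_{0,p}=1$ (empty sums are zero).
   Context: For an integer $p\ge0$, the $p$-Bell numbers $\mathcal{B}_{n,p}$ are defined by $\sum_{n\geq0}\mathcal{B}_{n,p}\frac{z^{n}}{n!}=\sum_{k\geq0}\binom{k+p}{p}^{ -1}\frac{(e^{z}-1)^{k}}{k!}$. -}

module Defs where

open import Data.Nat as ℕ using (ℕ; zero; suc; _≤_; z≤n; s≤s; _>_; NonZero; >-nonZero)
open import Data.Nat.Properties as ℕP using (m≤n+m; ≤-trans; m≤m+n)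
open import Data.Nat.Combinatorics using (_C_; nCk+nC[k+1]≡[n+1]C[k+1])
open import Data.Integer using (+_)
open import Data.Rational using (ℚ; _/_; _+_; _*_; -_; 0ℚ; 1ℚ)
open import Relation.Binary.PropositionalEquality using (subst; sym)

⟦_⟧ : ℕ → ℚ
⟦ n ⟧ = + n / 1

Σ< : ℕ → (ℕ → ℚ) → ℚ
Σ< zero    f = 0ℚ
Σ< (suc n) f = Σ< n f + f n

neg1^ : ℕ → ℚ
neg1^ zero    = 1ℚ
neg1^ (suc m) = - neg1^ m

-- Stirling numbers of the second kind S(n,k):
-- S(n,k) = coefficient of z^n/n! in (e^z - 1)^k / k!
S₂ : ℕ → ℕ → ℕ
S₂ zero    zero    = 1
S₂ zero    (suc k) = 0
S₂ (suc n) zero    = 0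
S₂ (suc n) (suc k) = suc k ℕ.* S₂ n (suc k) ℕ.+ S₂ n k

C-pos : ∀ n k → k ≤ n → n C k > 0
C-pos n zero _ = s≤s z≤n
C-pos (suc n) (suc k) (s≤s k≤n) =
  subst (_> 0) (nCk+nC[k+1]≡[n+1]C[k+1] n k)
        (≤-trans (C-pos n k k≤n) (m≤m+n (n C k) (n C suc k)))

binom-nonZero : ∀ k p → NonZero ((k ℕ.+ p) C p)
binom-nonZero k p = >-nonZero (C-pos (k ℕ.+ p) p (m≤n+m p k))

invBinom : ℕ → ℕ → ℚ
invBinom k p = (+ 1 / ((k ℕ.+ p) C p)) {{binom-nonZero k p}}

-- p-Bell numbers: B_{n,p} = n! [z^n] Σ_k binom(k+p,p)^{-1} (e^z-1)^k/k!
--                        = Σ_{k=0}^{n} S(n,k) / binom(k+p,p)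
pBell : ℕ → ℕ → ℚ
pBell n p = Σ< (suc n) (λ k → ⟦ S₂ n k ⟧ * invBinom k p)

{-# OPTIONS --safe #-}
module Submission where

-- B_{n,p} = Σ_k S(n,k) a_k is the Stirling transform of a_k = 1/C(k+p,p). The recurrence
-- S(n+1,k+1) = (k+1) S(n,k+1) + S(n,k) turns the Stirling transform of a at n+1 into that of
-- k a_k + a_{k+1} at n; by induction on n, the n-th forward difference of j ↦ B_{j+1,p} is therefore
-- the Stirling transform of the shifted sequence a_{k+1} (on generating functions: e^{-z} B_p'(z)).
-- Since a_k - a_{k+1} = p/(p+1) · 1/C(k+p+1,p+1), that transform is B_{n,p} - p/(p+1) B_{n,p+1},
-- and isolating the two top terms of the forward difference gives the recurrence.

open import Defs
open import Data.Nat as ℕ using (ℕ; zero; suc; _∸_; _<_; s≤s; NonZero)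
import Data.Nat.Properties as ℕP
open import Data.Nat.Combinatorics using (_C_; nCn≡1; nC1≡n; nCk≡nC[n∸k]; nCk+nC[k+1]≡[n+1]C[k+1]; k>n⇒nCk≡0)
open import Data.Integer as ℤ using (+_; 1ℤ)
import Data.Integer.Properties as ℤP
open import Data.Rational using (ℚ; _/_; _+_; _-_; _*_; -_; 0ℚ; 1ℚ; toℚᵘ)
import Data.Rational.Properties as ℚP
import Data.Rational.Unnormalised as ℚᵘ
import Data.Rational.Unnormalised.Properties as ℚᵘP
open import Data.Rational.Solver using (module +-*-Solver)
open import Data.Product using (_×_; _,_)
open import Relation.Binary.PropositionalEquality using (_≡_; refl; sym; trans; cong; cong₂; module ≡-Reasoning)
open import Relation.Nullary using (yes; no)

open ℚᵘ using (mkℚᵘ; *≡*; _≃_)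
open +-*-Solver using (solve; _:+_; _:*_; _:-_; :-_; con; _:=_)

-- ⟦ n ⟧ unfolds to fromℚᵘ (mkℚᵘ (+ n) 0), so identities about ⟦_⟧ are checked in ℚᵘ by cross-multiplication.
toℚᵘ-⟦⟧ : ∀ n → toℚᵘ ⟦ n ⟧ ≃ mkℚᵘ (+ n) 0
toℚᵘ-⟦⟧ n = ℚP.toℚᵘ-fromℚᵘ (mkℚᵘ (+ n) 0)

⟦⟧-+ : ∀ m n → ⟦ m ℕ.+ n ⟧ ≡ ⟦ m ⟧ + ⟦ n ⟧
⟦⟧-+ m n = ℚP.toℚᵘ-injective (begin
    toℚᵘ ⟦ m ℕ.+ n ⟧                ≈⟨ toℚᵘ-⟦⟧ (m ℕ.+ n) ⟩
    mkℚᵘ (+ (m ℕ.+ n)) 0            ≈⟨ *≡* (cong (ℤ._* 1ℤ) +[m+n]≡) ⟩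
    mkℚᵘ (+ m) 0 ℚᵘ.+ mkℚᵘ (+ n) 0  ≈⟨ ℚᵘP.+-cong (toℚᵘ-⟦⟧ m) (toℚᵘ-⟦⟧ n) ⟨
    toℚᵘ ⟦ m ⟧ ℚᵘ.+ toℚᵘ ⟦ n ⟧      ≈⟨ ℚP.toℚᵘ-homo-+ ⟦ m ⟧ ⟦ n ⟧ ⟨
    toℚᵘ (⟦ m ⟧ + ⟦ n ⟧)            ∎)
  where
  open ℚᵘP.≃-Reasoning
  +[m+n]≡ : + (m ℕ.+ n) ≡ + m ℤ.* 1ℤ ℤ.+ + n ℤ.* 1ℤ
  +[m+n]≡ = trans (ℤP.pos-+ m n) (sym (cong₂ ℤ._+_ (ℤP.*-identityʳ (+ m)) (ℤP.*-identityʳ (+ n))))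

⟦⟧-* : ∀ m n → ⟦ m ℕ.* n ⟧ ≡ ⟦ m ⟧ * ⟦ n ⟧
⟦⟧-* m n = ℚP.toℚᵘ-injective (begin
    toℚᵘ ⟦ m ℕ.* n ⟧                ≈⟨ toℚᵘ-⟦⟧ (m ℕ.* n) ⟩
    mkℚᵘ (+ (m ℕ.* n)) 0            ≈⟨ *≡* (cong (ℤ._* 1ℤ) (ℤP.pos-* m n)) ⟩
    mkℚᵘ (+ m) 0 ℚᵘ.* mkℚᵘ (+ n) 0  ≈⟨ ℚᵘP.*-cong (toℚᵘ-⟦⟧ m) (toℚᵘ-⟦⟧ n) ⟨
    toℚᵘ ⟦ m ⟧ ℚᵘ.* toℚᵘ ⟦ n ⟧      ≈⟨ ℚP.toℚᵘ-homo-* ⟦ m ⟧ ⟦ n ⟧ ⟨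
    toℚᵘ (⟦ m ⟧ * ⟦ n ⟧)            ∎)
  where open ℚᵘP.≃-Reasoning

⟦⟧-*-≡ : ∀ a b x y → a ℕ.* b ≡ x ℕ.* y → ⟦ a ⟧ * ⟦ b ⟧ ≡ ⟦ x ⟧ * ⟦ y ⟧
⟦⟧-*-≡ a b x y eq = trans (sym (⟦⟧-* a b)) (trans (cong ⟦_⟧ eq) (⟦⟧-* x y))

⟦d⟧*i/d≡⟦i⟧ : ∀ i d {{_ : NonZero d}} → ⟦ d ⟧ * (+ i / d) ≡ ⟦ i ⟧
⟦d⟧*i/d≡⟦i⟧ i (suc d) = ℚP.toℚᵘ-injective (begin
    toℚᵘ (⟦ suc d ⟧ * (+ i / suc d))               ≈⟨ ℚP.toℚᵘ-homo-* ⟦ suc d ⟧ (+ i / suc d) ⟩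
    toℚᵘ ⟦ suc d ⟧ ℚᵘ.* toℚᵘ (+ i / suc d)         ≈⟨ ℚᵘP.*-cong (toℚᵘ-⟦⟧ (suc d)) (ℚP.toℚᵘ-fromℚᵘ (mkℚᵘ (+ i) d)) ⟩
    mkℚᵘ (+ suc d) 0 ℚᵘ.* mkℚᵘ (+ i) d             ≈⟨ *≡* cross ⟩
    mkℚᵘ (+ i) 0                                   ≈⟨ toℚᵘ-⟦⟧ i ⟨
    toℚᵘ ⟦ i ⟧                                     ∎)
  where
  open ℚᵘP.≃-Reasoning
  cross : (+ suc d ℤ.* + i) ℤ.* 1ℤ ≡ + i ℤ.* + (1 ℕ.* suc d)
  cross = trans (ℤP.*-identityʳ _) (trans (ℤP.*-comm (+ suc d) (+ i)) (cong (λ e → + i ℤ.* + e) (sym (ℕP.*-identityˡ (suc d)))))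

Σ<-cong : ∀ n {f g : ℕ → ℚ} → (∀ k → f k ≡ g k) → Σ< n f ≡ Σ< n g
Σ<-cong zero    f≗g = refl
Σ<-cong (suc n) f≗g = cong₂ _+_ (Σ<-cong n f≗g) (f≗g n)

Σ<-+ : ∀ n (f g : ℕ → ℚ) → Σ< n (λ k → f k + g k) ≡ Σ< n f + Σ< n g
Σ<-+ zero    f g = sym (ℚP.+-identityˡ 0ℚ)
Σ<-+ (suc n) f g = trans (cong (_+ (f n + g n)) (Σ<-+ n f g))
  (solve 4 (λ F G x y → (F :+ G) :+ (x :+ y) := (F :+ x) :+ (G :+ y)) refl (Σ< n f) (Σ< n g) (f n) (g n))

Σ<-neg : ∀ n (f : ℕ → ℚ) → Σ< n (λ k → - f k) ≡ - Σ< n f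
Σ<-neg zero    f = refl
Σ<-neg (suc n) f = trans (cong (_+ - f n) (Σ<-neg n f)) (sym (ℚP.neg-distrib-+ (Σ< n f) (f n)))

Σ<-- : ∀ n (f g : ℕ → ℚ) → Σ< n (λ k → f k - g k) ≡ Σ< n f - Σ< n g
Σ<-- n f g = trans (Σ<-+ n f (λ k → - g k)) (cong (λ x → Σ< n f + x) (Σ<-neg n g))

Σ<-*ˡ : ∀ n c (f : ℕ → ℚ) → Σ< n (λ k → c * f k) ≡ c * Σ< n f
Σ<-*ˡ zero    c f = sym (ℚP.*-zeroʳ c)
Σ<-*ˡ (suc n) c f = trans (cong (_+ c * f n) (Σ<-*ˡ n c f)) (sym (ℚP.*-distribˡ-+ c (Σ< n f) (f n)))

Σ<-front : ∀ n (f : ℕ → ℚ) → Σ< (suc n) f ≡ f 0 + Σ< n (λ k → f (suc k))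
Σ<-front zero    f = ℚP.+-comm 0ℚ (f 0)
Σ<-front (suc n) f = trans (cong (_+ f (suc n)) (Σ<-front n f)) (ℚP.+-assoc (f 0) _ _)

Σ<-shift : ∀ n (f : ℕ → ℚ) → f 0 ≡ 0ℚ → f n ≡ 0ℚ → Σ< n (λ k → f (suc k)) ≡ Σ< n f
Σ<-shift n f f0≡0 fn≡0 = begin
  Σ< n (λ k → f (suc k))        ≡⟨ ℚP.+-identityˡ _ ⟨
  0ℚ + Σ< n (λ k → f (suc k))   ≡⟨ cong (_+ Σ< n (λ k → f (suc k))) f0≡0 ⟨
  f 0 + Σ< n (λ k → f (suc k))  ≡⟨ Σ<-front n f ⟨
  Σ< n f + f n                  ≡⟨ cong (λ x → Σ< n f + x) fn≡0 ⟩
  Σ< n f + 0ℚ                   ≡⟨ ℚP.+-identityʳ _ ⟩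
  Σ< n f                        ∎
  where open ≡-Reasoning

[k+1]*[n+1]C[k+1]≡[n+1]*nCk : ∀ n k → suc k ℕ.* (suc n C suc k) ≡ suc n ℕ.* (n C k)
[k+1]*[n+1]C[k+1]≡[n+1]*nCk zero    zero    = refl
[k+1]*[n+1]C[k+1]≡[n+1]*nCk zero    (suc k) = ℕP.*-zeroʳ (suc (suc k))
[k+1]*[n+1]C[k+1]≡[n+1]*nCk (suc n) zero    = trans (ℕP.+-identityʳ _) (trans (nC1≡n (suc (suc n))) (sym (ℕP.*-identityʳ (suc (suc n)))))
[k+1]*[n+1]C[k+1]≡[n+1]*nCk (suc n) (suc k) = begin
  suc (suc k) ℕ.* (suc (suc n) C suc (suc k))
    ≡⟨ cong (suc (suc k) ℕ.*_) (nCk+nC[k+1]≡[n+1]C[k+1] (suc n) (suc k)) ⟨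
  suc (suc k) ℕ.* (A ℕ.+ B)
    ≡⟨ ℕP.*-distribˡ-+ (suc (suc k)) A B ⟩
  A ℕ.+ suc k ℕ.* A ℕ.+ suc (suc k) ℕ.* B
    ≡⟨ cong₂ (λ x y → A ℕ.+ x ℕ.+ y) ([k+1]*[n+1]C[k+1]≡[n+1]*nCk n k) ([k+1]*[n+1]C[k+1]≡[n+1]*nCk n (suc k)) ⟩
  A ℕ.+ suc n ℕ.* (n C k) ℕ.+ suc n ℕ.* (n C suc k)
    ≡⟨ ℕP.+-assoc A _ _ ⟩
  A ℕ.+ (suc n ℕ.* (n C k) ℕ.+ suc n ℕ.* (n C suc k))
    ≡⟨ cong (A ℕ.+_) (ℕP.*-distribˡ-+ (suc n) (n C k) (n C suc k)) ⟨
  A ℕ.+ suc n ℕ.* (n C k ℕ.+ n C suc k)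
    ≡⟨ cong (λ x → A ℕ.+ suc n ℕ.* x) (nCk+nC[k+1]≡[n+1]C[k+1] n k) ⟩
  A ℕ.+ suc n ℕ.* A
    ∎
  where
  open ≡-Reasoning
  A B : ℕ
  A = suc n C suc k
  B = suc n C suc (suc k)

[m+n]Cn≡[m+n]Cm : ∀ m n → (m ℕ.+ n) C n ≡ (m ℕ.+ n) C m
[m+n]Cn≡[m+n]Cm m n = trans (nCk≡nC[n∸k] (ℕP.m≤n+m n m)) (cong ((m ℕ.+ n) C_) (ℕP.m+n∸n≡m m n))

[k+1]*[k+1+p]Cp≡[k+1+p]*[k+p]Cp : ∀ k p → suc k ℕ.* ((suc k ℕ.+ p) C p) ≡ (suc k ℕ.+ p) ℕ.* ((k ℕ.+ p) C p)
[k+1]*[k+1+p]Cp≡[k+1+p]*[k+p]Cp k p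
  rewrite [m+n]Cn≡[m+n]Cm (suc k) p | [m+n]Cn≡[m+n]Cm k p = [k+1]*[n+1]C[k+1]≡[n+1]*nCk (k ℕ.+ p) k

[p+1]*[k+p+1]C[p+1]≡[k+1+p]*[k+p]Cp : ∀ k p → suc p ℕ.* ((k ℕ.+ suc p) C suc p) ≡ (suc k ℕ.+ p) ℕ.* ((k ℕ.+ p) C p)
[p+1]*[k+p+1]C[p+1]≡[k+1+p]*[k+p]Cp k p rewrite ℕP.+-suc k p = [k+1]*[n+1]C[k+1]≡[n+1]*nCk (k ℕ.+ p) p

inverse-by-cross-multiplication : ∀ c u M m d v K → c * u ≡ 1ℚ → M * m ≡ 1ℚ → d * v ≡ 1ℚ →
                                  K * d ≡ M * c → v ≡ K * m * u
inverse-by-cross-multiplication c u M m d v K c*u≡1 M*m≡1 d*v≡1 K*d≡M*c = begin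
  v                      ≡⟨ solve 1 (λ v → v := v :* con 1ℚ :* con 1ℚ) refl v ⟩
  v * 1ℚ * 1ℚ            ≡⟨ cong₂ (λ x y → v * x * y) c*u≡1 M*m≡1 ⟨
  v * (c * u) * (M * m)  ≡⟨ solve 5 (λ v c u M m → v :* (c :* u) :* (M :* m) := M :* c :* v :* m :* u) refl v c u M m ⟩
  M * c * v * m * u      ≡⟨ cong (λ x → x * v * m * u) K*d≡M*c ⟨
  K * d * v * m * u      ≡⟨ solve 5 (λ K d v m u → K :* d :* v :* m :* u := K :* m :* u :* (d :* v)) refl K d v m u ⟩
  K * m * u * (d * v)    ≡⟨ cong (K * m * u *_) d*v≡1 ⟩
  K * m * u * 1ℚ         ≡⟨ ℚP.*-identityʳ _ ⟩
  K * m * u              ∎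
  where open ≡-Reasoning

-- The two binomial identities above write 1/C(k+1+p,p) and 1/C(k+p+1,p+1) as multiples of u/(k+1+p), u = 1/C(k+p,p).
invBinom-suc : ∀ k p → invBinom (suc k) p ≡ invBinom k p - (+ p / suc p) * invBinom k (suc p)
invBinom-suc k p = begin
  v                           ≡⟨ v≡K*m*u ⟩
  K * m * u                   ≡⟨ solve 4 (λ K P m u → K :* m :* u := (K :+ P) :* m :* u :- P :* m :* u) refl K P m u ⟩
  (K + P) * m * u - P * m * u ≡⟨ cong (λ x → x * u - P * m * u) [K+P]*m≡1 ⟩
  1ℚ * u - P * m * u          ≡⟨ cong₂ _-_ (ℚP.*-identityˡ u) (cong (λ x → x * m * u) (sym P₁*r≡P)) ⟩
  u - P₁ * r * m * u          ≡⟨ cong (λ x → u - x) (solve 4 (λ P₁ r m u → P₁ :* r :* m :* u := r :* (P₁ :* m :* u)) refl P₁ r m u) ⟩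
  u - r * (P₁ * m * u)        ≡⟨ cong (λ x → u - r * x) w≡P₁*m*u ⟨
  u - r * w                   ∎
  where
  open ≡-Reasoning
  M c d e : ℕ
  M = suc k ℕ.+ p
  c = (k ℕ.+ p) C p
  d = (suc k ℕ.+ p) C p
  e = (k ℕ.+ suc p) C suc p
  u v w r K P P₁ m : ℚ
  u = invBinom k p
  v = invBinom (suc k) p
  w = invBinom k (suc p)
  r = + p / suc p
  K = ⟦ suc k ⟧
  P = ⟦ p ⟧
  P₁ = ⟦ suc p ⟧
  m = + 1 / M
  [K+P]*m≡1 : (K + P) * m ≡ 1ℚ
  [K+P]*m≡1 = trans (cong (_* m) (sym (⟦⟧-+ (suc k) p))) (⟦d⟧*i/d≡⟦i⟧ 1 M)
  P₁*r≡P : P₁ * r ≡ P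
  P₁*r≡P = ⟦d⟧*i/d≡⟦i⟧ p (suc p)
  v≡K*m*u : v ≡ K * m * u
  v≡K*m*u = inverse-by-cross-multiplication ⟦ c ⟧ u ⟦ M ⟧ m ⟦ d ⟧ v K
    (⟦d⟧*i/d≡⟦i⟧ 1 c {{binom-nonZero k p}}) (⟦d⟧*i/d≡⟦i⟧ 1 M) (⟦d⟧*i/d≡⟦i⟧ 1 d {{binom-nonZero (suc k) p}})
    (⟦⟧-*-≡ (suc k) d M c ([k+1]*[k+1+p]Cp≡[k+1+p]*[k+p]Cp k p))
  w≡P₁*m*u : w ≡ P₁ * m * u
  w≡P₁*m*u = inverse-by-cross-multiplication ⟦ c ⟧ u ⟦ M ⟧ m ⟦ e ⟧ w P₁
    (⟦d⟧*i/d≡⟦i⟧ 1 c {{binom-nonZero k p}}) (⟦d⟧*i/d≡⟦i⟧ 1 M) (⟦d⟧*i/d≡⟦i⟧ 1 e {{binom-nonZero k (suc p)}})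
    (⟦⟧-*-≡ (suc p) e M c ([p+1]*[k+p+1]C[p+1]≡[k+1+p]*[k+p]Cp k p))

S₂-vanishes : ∀ {n k} → n < k → S₂ n k ≡ 0
S₂-vanishes {zero}  {suc k} _ = refl
S₂-vanishes {suc n} {suc k} (s≤s n<k)
  rewrite S₂-vanishes (ℕP.m<n⇒m<1+n n<k) | S₂-vanishes n<k | ℕP.*-zeroʳ k = refl

-- The Stirling transform; pBell n p unfolds to stirling (λ k → invBinom k p) n.
stirling : (ℕ → ℚ) → ℕ → ℚ
stirling a n = Σ< (suc n) (λ k → ⟦ S₂ n k ⟧ * a k)

stirling-cong : ∀ n {a b : ℕ → ℚ} → (∀ k → a k ≡ b k) → stirling a n ≡ stirling b n
stirling-cong n a≗b = Σ<-cong (suc n) (λ k → cong (⟦ S₂ n k ⟧ *_) (a≗b k))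

stirling-- : ∀ n (a b : ℕ → ℚ) → stirling (λ k → a k - b k) n ≡ stirling a n - stirling b n
stirling-- n a b = trans
  (Σ<-cong (suc n) (λ k → solve 3 (λ s x y → s :* (x :- y) := s :* x :- s :* y) refl ⟦ S₂ n k ⟧ (a k) (b k)))
  (Σ<-- (suc n) (λ k → ⟦ S₂ n k ⟧ * a k) (λ k → ⟦ S₂ n k ⟧ * b k))

stirling-*ˡ : ∀ n r (a : ℕ → ℚ) → stirling (λ k → r * a k) n ≡ r * stirling a n
stirling-*ˡ n r a = trans
  (Σ<-cong (suc n) (λ k → solve 3 (λ s r x → s :* (r :* x) := r :* (s :* x)) refl ⟦ S₂ n k ⟧ r (a k)))
  (Σ<-*ˡ (suc n) r (λ k → ⟦ S₂ n k ⟧ * a k))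

stirling-zero : ∀ (a : ℕ → ℚ) → stirling a 0 ≡ a 0
stirling-zero a = solve 1 (λ x → con 0ℚ :+ con 1ℚ :* x := x) refl (a 0)

stirling-suc : ∀ (a : ℕ → ℚ) n → stirling a (suc n) ≡ stirling (λ k → ⟦ k ⟧ * a k + a (suc k)) n
stirling-suc a n = begin
  stirling a (suc n)
    ≡⟨ Σ<-front (suc n) _ ⟩
  0ℚ * a 0 + Σ< (suc n) (λ k → ⟦ S₂ (suc n) (suc k) ⟧ * a (suc k))
    ≡⟨ cong₂ _+_ (ℚP.*-zeroˡ (a 0)) (Σ<-cong (suc n) S₂-rec) ⟩
  0ℚ + Σ< (suc n) (λ k → g (suc k) + ⟦ S₂ n k ⟧ * a (suc k))
    ≡⟨ trans (ℚP.+-identityˡ _) (Σ<-+ (suc n) _ _) ⟩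
  Σ< (suc n) (λ k → g (suc k)) + Σ< (suc n) (λ k → ⟦ S₂ n k ⟧ * a (suc k))
    ≡⟨ cong (_+ Σ< (suc n) (λ k → ⟦ S₂ n k ⟧ * a (suc k))) (Σ<-shift (suc n) g (ℚP.*-zeroˡ (⟦ S₂ n 0 ⟧ * a 0)) g[n+1]≡0) ⟩
  Σ< (suc n) g + Σ< (suc n) (λ k → ⟦ S₂ n k ⟧ * a (suc k))
    ≡⟨ Σ<-+ (suc n) _ _ ⟨
  Σ< (suc n) (λ k → g k + ⟦ S₂ n k ⟧ * a (suc k))
    ≡⟨ Σ<-cong (suc n) (λ k → solve 4 (λ K s x y → K :* (s :* x) :+ s :* y := s :* (K :* x :+ y)) refl ⟦ k ⟧ ⟦ S₂ n k ⟧ (a k) (a (suc k))) ⟩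
  stirling (λ k → ⟦ k ⟧ * a k + a (suc k)) n
    ∎
  where
  open ≡-Reasoning
  g : ℕ → ℚ
  g k = ⟦ k ⟧ * (⟦ S₂ n k ⟧ * a k)
  S₂-rec : ∀ k → ⟦ S₂ (suc n) (suc k) ⟧ * a (suc k) ≡ g (suc k) + ⟦ S₂ n k ⟧ * a (suc k)
  S₂-rec k = begin
    ⟦ suc k ℕ.* S₂ n (suc k) ℕ.+ S₂ n k ⟧ * a (suc k)
      ≡⟨ cong (_* a (suc k)) (trans (⟦⟧-+ (suc k ℕ.* S₂ n (suc k)) (S₂ n k)) (cong (_+ ⟦ S₂ n k ⟧) (⟦⟧-* (suc k) (S₂ n (suc k))))) ⟩
    (⟦ suc k ⟧ * ⟦ S₂ n (suc k) ⟧ + ⟦ S₂ n k ⟧) * a (suc k)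
      ≡⟨ solve 4 (λ K s t x → (K :* s :+ t) :* x := K :* (s :* x) :+ t :* x) refl ⟦ suc k ⟧ ⟦ S₂ n (suc k) ⟧ ⟦ S₂ n k ⟧ (a (suc k)) ⟩
    g (suc k) + ⟦ S₂ n k ⟧ * a (suc k)
      ∎
  g[n+1]≡0 : g (suc n) ≡ 0ℚ
  g[n+1]≡0 rewrite S₂-vanishes (ℕP.n<1+n n) = trans (cong (⟦ suc n ⟧ *_) (ℚP.*-zeroˡ (a (suc n)))) (ℚP.*-zeroʳ ⟦ suc n ⟧)

Δ-term : ℕ → (ℕ → ℚ) → ℕ → ℚ
Δ-term n F j = ⟦ n C j ⟧ * neg1^ (n ∸ j) * F j

Δ : ℕ → (ℕ → ℚ) → ℚ
Δ n F = Σ< (suc n) (Δ-term n F)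

Δ-cong : ∀ n {F G : ℕ → ℚ} → (∀ j → F j ≡ G j) → Δ n F ≡ Δ n G
Δ-cong n F≗G = Σ<-cong (suc n) (λ j → cong (⟦ n C j ⟧ * neg1^ (n ∸ j) *_) (F≗G j))

Δ-zero : ∀ (F : ℕ → ℚ) → Δ 0 F ≡ F 0
Δ-zero F = solve 1 (λ x → con 0ℚ :+ con 1ℚ :* con 1ℚ :* x := x) refl (F 0)

neg1^-∸ : ∀ {n j} → j < n → neg1^ (n ∸ j) ≡ - neg1^ (n ∸ suc j)
neg1^-∸ {suc n} {zero}  _         = refl
neg1^-∸ {suc n} {suc j} (s≤s j<n) = neg1^-∸ j<n

-- For j ≥ n truncated subtraction breaks the sign flip, but then n C suc j = 0.
nC[j+1]*neg1^-∸ : ∀ n j → ⟦ n C suc j ⟧ * neg1^ (n ∸ j) ≡ - (⟦ n C suc j ⟧ * neg1^ (n ∸ suc j))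
nC[j+1]*neg1^-∸ n j with j ℕ.<? n
... | yes j<n = trans (cong (⟦ n C suc j ⟧ *_) (neg1^-∸ j<n)) (sym (ℚP.neg-distribʳ-* ⟦ n C suc j ⟧ (neg1^ (n ∸ suc j))))
... | no  j≮n rewrite k>n⇒nCk≡0 {n} {suc j} (s≤s (ℕP.≮⇒≥ j≮n)) =
  trans (ℚP.*-zeroˡ (neg1^ (n ∸ j))) (sym (cong -_ (ℚP.*-zeroˡ (neg1^ (n ∸ suc j)))))

Δ-term-suc : ∀ n (F : ℕ → ℚ) j → Δ-term (suc n) F (suc j) ≡ Δ-term n (λ i → F (suc i)) j - Δ-term n F (suc j)
Δ-term-suc n F j = begin
  ⟦ suc n C suc j ⟧ * s * f                       ≡⟨ cong (λ c → ⟦ c ⟧ * s * f) (nCk+nC[k+1]≡[n+1]C[k+1] n j) ⟨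
  ⟦ n C j ℕ.+ n C suc j ⟧ * s * f                 ≡⟨ cong (λ c → c * s * f) (⟦⟧-+ (n C j) (n C suc j)) ⟩
  (⟦ n C j ⟧ + ⟦ n C suc j ⟧) * s * f             ≡⟨ solve 4 (λ a b s f → (a :+ b) :* s :* f := a :* s :* f :+ b :* s :* f) refl ⟦ n C j ⟧ ⟦ n C suc j ⟧ s f ⟩
  ⟦ n C j ⟧ * s * f + ⟦ n C suc j ⟧ * s * f       ≡⟨ cong (λ x → ⟦ n C j ⟧ * s * f + x * f) (nC[j+1]*neg1^-∸ n j) ⟩
  ⟦ n C j ⟧ * s * f + - (⟦ n C suc j ⟧ * s′) * f  ≡⟨ cong (λ x → ⟦ n C j ⟧ * s * f + x) (ℚP.neg-distribˡ-* (⟦ n C suc j ⟧ * s′) f) ⟨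
  ⟦ n C j ⟧ * s * f - ⟦ n C suc j ⟧ * s′ * f      ∎
  where
  open ≡-Reasoning
  s s′ f : ℚ
  s = neg1^ (n ∸ j)
  s′ = neg1^ (n ∸ suc j)
  f = F (suc j)

Δ-suc : ∀ n (F : ℕ → ℚ) → Δ (suc n) F ≡ Δ n (λ j → F (suc j)) - Δ n F
Δ-suc n F = begin
  Δ (suc n) F
    ≡⟨ Σ<-front (suc n) (Δ-term (suc n) F) ⟩
  Δ-term (suc n) F 0 + Σ< (suc n) (λ j → Δ-term (suc n) F (suc j))
    ≡⟨ cong₂ _+_ t′[0]≡-t[0] (Σ<-cong (suc n) (Δ-term-suc n F)) ⟩
  - t 0 + Σ< (suc n) (λ j → Δ-term n F′ j - t (suc j))
    ≡⟨ cong (λ x → - t 0 + x) (Σ<-- (suc n) (Δ-term n F′) (λ j → t (suc j))) ⟩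
  - t 0 + (Δ n F′ - Σ< (suc n) (λ j → t (suc j)))
    ≡⟨ solve 3 (λ x D y → :- x :+ (D :- y) := D :- (x :+ y)) refl (t 0) (Δ n F′) (Σ< (suc n) (λ j → t (suc j))) ⟩
  Δ n F′ - (t 0 + Σ< (suc n) (λ j → t (suc j)))
    ≡⟨ cong (λ x → Δ n F′ - x) (Σ<-front (suc n) t) ⟨
  Δ n F′ - (Δ n F + t (suc n))
    ≡⟨ cong (λ x → Δ n F′ - (Δ n F + x)) t[n+1]≡0 ⟩
  Δ n F′ - (Δ n F + 0ℚ)
    ≡⟨ cong (λ x → Δ n F′ - x) (ℚP.+-identityʳ (Δ n F)) ⟩
  Δ n F′ - Δ n F
    ∎
  where
  open ≡-Reasoning
  F′ : ℕ → ℚ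
  F′ j = F (suc j)
  t : ℕ → ℚ
  t = Δ-term n F
  t′[0]≡-t[0] : Δ-term (suc n) F 0 ≡ - t 0
  t′[0]≡-t[0] = solve 2 (λ s f → con 1ℚ :* (:- s) :* f := :- (con 1ℚ :* s :* f)) refl (neg1^ n) (F 0)
  t[n+1]≡0 : t (suc n) ≡ 0ℚ
  t[n+1]≡0 rewrite k>n⇒nCk≡0 {n} {suc n} (ℕP.n<1+n n) =
    trans (cong (_* F (suc n)) (ℚP.*-zeroˡ (neg1^ (n ∸ suc n)))) (ℚP.*-zeroˡ (F (suc n)))

Δ-stirling : ∀ n (a : ℕ → ℚ) → Δ n (λ j → stirling a (suc j)) ≡ stirling (λ k → a (suc k)) n
Δ-stirling zero a = begin
  Δ 0 (λ j → stirling a (suc j))              ≡⟨ Δ-zero (λ j → stirling a (suc j)) ⟩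
  stirling a 1                                ≡⟨ stirling-suc a 0 ⟩
  stirling (λ k → ⟦ k ⟧ * a k + a (suc k)) 0  ≡⟨ stirling-zero (λ k → ⟦ k ⟧ * a k + a (suc k)) ⟩
  0ℚ * a 0 + a 1                              ≡⟨ solve 2 (λ x y → con 0ℚ :* x :+ y := y) refl (a 0) (a 1) ⟩
  a 1                                         ≡⟨ stirling-zero (λ k → a (suc k)) ⟨
  stirling (λ k → a (suc k)) 0                ∎
  where open ≡-Reasoning
Δ-stirling (suc n) a = begin
  Δ (suc n) (λ j → stirling a (suc j))
    ≡⟨ Δ-suc n (λ j → stirling a (suc j)) ⟩
  Δ n (λ j → stirling a (suc (suc j))) - Δ n (λ j → stirling a (suc j))
    ≡⟨ cong₂ _-_ (trans (Δ-cong n (λ j → stirling-suc a (suc j))) (Δ-stirling n b)) (Δ-stirling n a) ⟩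
  stirling (λ k → b (suc k)) n - stirling (λ k → a (suc k)) n
    ≡⟨ stirling-- n (λ k → b (suc k)) (λ k → a (suc k)) ⟨
  stirling (λ k → b (suc k) - a (suc k)) n
    ≡⟨ stirling-cong n b[k+1]-a[k+1]≡ ⟩
  stirling (λ k → ⟦ k ⟧ * a (suc k) + a (suc (suc k))) n
    ≡⟨ stirling-suc (λ k → a (suc k)) n ⟨
  stirling (λ k → a (suc k)) (suc n)
    ∎
  where
  open ≡-Reasoning
  b : ℕ → ℚ
  b k = ⟦ k ⟧ * a k + a (suc k)
  b[k+1]-a[k+1]≡ : ∀ k → b (suc k) - a (suc k) ≡ ⟦ k ⟧ * a (suc k) + a (suc (suc k))
  b[k+1]-a[k+1]≡ k = trans (cong (λ K → K * a (suc k) + a (suc (suc k)) - a (suc k)) (⟦⟧-+ 1 k))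
    (solve 3 (λ K x y → (con 1ℚ :+ K) :* x :+ y :- x := K :* x :+ y) refl ⟦ k ⟧ (a (suc k)) (a (suc (suc k))))

-- Stated for F ∘ suc so that the (n-1)-st term is F n also for n = 0, where its coefficient ⟦ n ⟧ vanishes.
Δ-top-terms : ∀ n (F : ℕ → ℚ) →
  Δ n (λ j → F (suc j)) ≡ Σ< (n ∸ 1) (Δ-term n (λ j → F (suc j))) - ⟦ n ⟧ * F n + F (suc n)
Δ-top-terms zero    F = solve 2 (λ x y → con 0ℚ :+ con 1ℚ :* con 1ℚ :* y := con 0ℚ :- con 0ℚ :* x :+ y) refl (F 0) (F 1)
Δ-top-terms (suc m) F = begin
  Σ< m t + t m + t (suc m)
    ≡⟨ cong₂ (λ x y → Σ< m t + x + y) t[m]≡ t[m+1]≡ ⟩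
  Σ< m t + ⟦ suc m ⟧ * (- 1ℚ) * F (suc m) + 1ℚ * 1ℚ * F (suc (suc m))
    ≡⟨ solve 4 (λ S N x y → S :+ N :* (:- con 1ℚ) :* x :+ con 1ℚ :* con 1ℚ :* y := S :- N :* x :+ y) refl
               (Σ< m t) ⟦ suc m ⟧ (F (suc m)) (F (suc (suc m))) ⟩
  Σ< m t - ⟦ suc m ⟧ * F (suc m) + F (suc (suc m))
    ∎
  where
  open ≡-Reasoning
  t : ℕ → ℚ
  t = Δ-term (suc m) (λ j → F (suc j))
  [m+1]Cm≡m+1 : suc m C m ≡ suc m
  [m+1]Cm≡m+1 = trans (nCk≡nC[n∸k] (ℕP.n≤1+n m)) (trans (cong (suc m C_) (ℕP.m+n∸n≡m 1 m)) (nC1≡n (suc m)))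
  t[m]≡ : t m ≡ ⟦ suc m ⟧ * (- 1ℚ) * F (suc m)
  t[m]≡ = cong₂ (λ c e → ⟦ c ⟧ * neg1^ e * F (suc m)) [m+1]Cm≡m+1 (ℕP.m+n∸n≡m 1 m)
  t[m+1]≡ : t (suc m) ≡ 1ℚ * 1ℚ * F (suc (suc m))
  t[m+1]≡ = cong₂ (λ c e → ⟦ c ⟧ * neg1^ e * F (suc (suc m))) (nCn≡1 (suc m)) (ℕP.n∸n≡0 (suc m))

pBell-zero : ∀ p → pBell 0 p ≡ 1ℚ
pBell-zero p = trans (stirling-zero (λ k → invBinom k p)) (ℚP./-cong {+ 1} {p C p} {+ 1} {1} {{binom-nonZero 0 p}} refl (nCn≡1 p))

pBell-shift : ∀ n p → stirling (λ k → invBinom (suc k) p) n ≡ pBell n p - (+ p / suc p) * pBell n (suc p)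
pBell-shift n p = begin
  stirling (λ k → invBinom (suc k) p) n
    ≡⟨ stirling-cong n (λ k → invBinom-suc k p) ⟩
  stirling (λ k → invBinom k p - r * invBinom k (suc p)) n
    ≡⟨ stirling-- n (λ k → invBinom k p) (λ k → r * invBinom k (suc p)) ⟩
  pBell n p - stirling (λ k → r * invBinom k (suc p)) n
    ≡⟨ cong (λ x → pBell n p - x) (stirling-*ˡ n r (λ k → invBinom k (suc p))) ⟩
  pBell n p - r * pBell n (suc p)
    ∎
  where
  open ≡-Reasoning
  r : ℚ
  r = + p / suc p

mainTheorem11 : (∀ (p : ℕ) → pBell 0 p ≡ 1ℚ)
    × (∀ (n p : ℕ) →
        pBell (suc n) p
          ≡ ⟦ suc n ⟧ * pBell n p
            - Σ< (n ∸ 1) (λ k → ⟦ n C k ⟧ * neg1^ (n ∸ k) * pBell (suc k) p)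
            - (+ p / suc p) * pBell n (suc p))
mainTheorem11 = pBell-zero , recurrence
  where
  open ≡-Reasoning
  solve-for-last : ∀ S N B B₁ R → S - N * B + B₁ ≡ B - R → B₁ ≡ (1ℚ + N) * B - S - R
  solve-for-last S N B B₁ R eq = begin
    B₁                         ≡⟨ solve 4 (λ S N B B₁ → B₁ := S :- N :* B :+ B₁ :- S :+ N :* B) refl S N B B₁ ⟩
    S - N * B + B₁ - S + N * B ≡⟨ cong (λ x → x - S + N * B) eq ⟩
    B - R - S + N * B          ≡⟨ solve 4 (λ S N B R → B :- R :- S :+ N :* B := (con 1ℚ :+ N) :* B :- S :- R) refl S N B R ⟩
    (1ℚ + N) * B - S - R       ∎
  recurrence : ∀ n p → pBell (suc n) p ≡ ⟦ suc n ⟧ * pBell n p - Σ< (n ∸ 1) (Δ-term n (λ k → pBell (suc k) p)) - (+ p / suc p) * pBell n (suc p)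
  recurrence n p = trans (solve-for-last S ⟦ n ⟧ (pBell n p) (pBell (suc n) p) R (begin
      S - ⟦ n ⟧ * pBell n p + pBell (suc n) p  ≡⟨ Δ-top-terms n (λ j → pBell j p) ⟨
      Δ n (λ j → pBell (suc j) p)             ≡⟨ Δ-stirling n (λ k → invBinom k p) ⟩
      stirling (λ k → invBinom (suc k) p) n   ≡⟨ pBell-shift n p ⟩
      pBell n p - R                           ∎))
    (cong (λ N → N * pBell n p - S - R) (sym (⟦⟧-+ 1 n)))
    where
    S R : ℚ
    S = Σ< (n ∸ 1) (Δ-term n (λ k → pBell (suc k) p))
    R = (+ p / suc p) * pBell n (suc p)
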